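{- Let $d$ be a positive integer and let $p_{1},p_{2}\geq 2$ be integers. For $n\in\mathbb{N}$ let $A_{p_{1},p_{2}}(n)$, $B_{p_{1},p_{2}}(n)$ and $C_{p_{1},p_{2}}(n)$ be the partition counts defined in the context below. \begin{enumerate} \item If $p_{1}=2$ and $p_{2}$ is odd, then $A_{2,p_{2}}(n)\equiv B_{2,p_{2}}(n)\pmod{2}$ for all $n\in\mathbb{N}$. \item If $p_{1}$ is a prime with $p_{1}\geq 3$, $p_{2}\geq 2$ is an integer and $p_{1}\nmid p_{2}$, then for every integer $n\geq 1$, $$\sum_{i=0}^{n}A_{p_{1},p_{2}}(i)\,C_{p_{1},p_{2}}(n-i)\equiv 0\pmod{p_{1}}.$$ \end{enumerate}
   Context: Fix a positive integer $d$ and integers $p_{1},p_{2}\geq 2$ with $\gcd(p_{1},p_{2})=1$ (this holds under the hypotheses of each part). A partition of $n\in\mathbb{N}$ into parts from a set $S\subset\mathbb{N}_{+}$ is a representation $n=a_{1}+\dots+a_{k}$ with $a_{i}\in S$, order disregarded. $A_{p_{1},p_{2}}(n)$ is the number of partitions of $n$ into parts of the form $k^{d}$ where $k\geq 1$ is divisible neither by $p_{1}$ nor by $p_{2}$ (equivalently, $d$-th powers not divisible by $p_{1}^{d}$ nor by $p_{2}^{d}$); its generating function is $\sum_{n\ge0}A_{p_{1},p_{2}}(n)q^{n}=\prod_{n=1}^{\infty}\frac{(1-q^{(p_{1}n)^{d}})(1-q^{(p_{2}n)^{d}})}{(1-q^{n^{d}})(1-q^{(p_{1}p_{2}n)^{d}})}$.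 $B_{p_{1},p_{2}}(n)$ is the number of partitions of $n$ into distinct $d$-th powers not divisible by $p_{2}^{d}$, where each part carries one of $p_{1}^{d}-1$ colors (a given part with a given color appears at most once); its generating function is $\prod_{n=1}^{\infty}\left(\frac{1+q^{n^{d}}}{1+q^{(p_{2}n)^{d}}}\right)^{p_{1}^{d}-1}$. $C_{p_{1},p_{2}}(n)$ is the number of partitions of $n$ into $d$-th powers not divisible by $p_{2}^{d}$, where each part carries one of $p_{1}^{d}-1$ colors (repetitions allowed); its generating function is $\prod_{n=1}^{\infty}\left(\frac{1-q^{(p_{2}n)^{d}}}{1-q^{n^{d}}}\right)^{p_{1}^{d}-1}$. -}

module Defs where

open import Data.Nat using (ℕ; zero; suc; _+_; _*_; _∸_; _^_; _≤ᵇ_)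
open import Data.Nat.Divisibility using (_∣?_)
open import Data.Nat.ListAction using (sum)
open import Data.List using (List; []; _∷_; map; upTo; filter; concatMap; replicate)
open import Data.Bool using (Bool; true; false; if_then_else_; not; _∧_)
open import Relation.Nullary using (¬?)

-- A "part type" is a natural number (its size).  A list of part types may
-- contain the same size several times: equal sizes at different positions
-- count as different (e.g. differently coloured) parts.

countRep : List ℕ → ℕ → ℕ
countRep [] zero = 1
countRep [] (suc _) = 0
countRep (s ∷ ss) n =
  sum (map (λ m → if m * s ≤ᵇ n then countRep ss (n ∸ m * s) else 0) (upTo (suc n)))

countDist : List ℕ → ℕ → ℕ
countDist [] zero = 1
countDist [] (suc _) = 0
countDist (s ∷ ss) n =
  countDist ss n + (if s ≤ᵇ n then countDist ss (n ∸ s) else 0)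

oneTo : ℕ → List ℕ
oneTo n = map suc (upTo n)

-- The bases k ∈ {1..n} with p ∤ k  (parts k^d with k > n exceed n anyway, since k^d ≥ k).
basesNotDiv : ℕ → ℕ → List ℕ
basesNotDiv p n = filter (λ k → ¬? (p ∣? k)) (oneTo n)

A : (d p₁ p₂ : ℕ) → ℕ → ℕ
A d p₁ p₂ n =
  countRep (map (λ k → k ^ d) (filter (λ k → ¬? (p₁ ∣? k)) (basesNotDiv p₂ n))) n

colouredParts : (d p₁ p₂ : ℕ) → ℕ → List ℕ
colouredParts d p₁ p₂ n =
  concatMap (λ k → replicate (p₁ ^ d ∸ 1) (k ^ d)) (basesNotDiv p₂ n)

B : (d p₁ p₂ : ℕ) → ℕ → ℕ
B d p₁ p₂ n = countDist (colouredParts d p₁ p₂ n) n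

C : (d p₁ p₂ : ℕ) → ℕ → ℕ
C d p₁ p₂ n = countRep (colouredParts d p₁ p₂ n) n

convAC : (d p₁ p₂ : ℕ) → ℕ → ℕ
convAC d p₁ p₂ n = sum (map (λ i → A d p₁ p₂ i * C d p₁ p₂ (n ∸ i)) (upTo (suc n)))

{-# OPTIONS --safe #-}

-- All generating functions involved are products of the factors G_t = 1/(1 - q^t) and
-- 1 + q^t, realised as operators on coefficient sequences; congruences of series are
-- checked coefficientwise up to a degree n, where only the factors with t ≤ n act.
-- The key fact is Frobenius: (1 - q)^p ≡ 1 - q^p (mod p) for a prime p, hence
-- G_t^(p^d) ≡ G_(p^d t). With
--   A = ∏_{p∤k, p₂∤k} G_(k^d),   C = ∏_{p₂∤k} G_(k^d)^(p^d - 1),   W = ∏_{p∣k, p₂∤k} G_(k^d)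
-- one gets W·A·C = ∏_{p₂∤k} G_(k^d)^(p^d) ≡ ∏_{p₂∤k} G_((pk)^d) = W, because p₂ ∤ pk iff
-- p₂ ∤ k. Cancelling W gives A·C ≡ 1 (mod p), which is part 2. For p = 2 moreover
-- 1 + q^t ≡ 1 - q^t, so the generating function B of part 1 satisfies B·C ≡ 1 as well,
-- and cancelling C gives A ≡ B (mod 2).

module Submission where

open import Defs
open import Data.Nat using (ℕ; _≤_; _%_)
open import Data.Nat.Divisibility using (_∣_)
open import Data.Nat.Primality using (Prime)
open import Data.Product using (_×_)
open import Relation.Nullary using (¬_)
open import Relation.Binary.PropositionalEquality using (_≡_)

open import Data.Bool using (Bool; true; false; if_then_else_; not)
open import Data.Empty using (⊥-elim)
open import Data.Integer as ℤ using (ℤ; +_; 0ℤ; 1ℤ; -1ℤ; _+_; _*_; -_; _-_)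
import Data.Integer.Properties as ℤ
open import Data.Integer.Tactic.RingSolver using (solve-∀)
open import Data.List using (List; []; _∷_; _++_; map; upTo; applyUpTo; filter; concatMap; replicate)
import Data.List.Properties as List
open import Data.Nat as ℕ using (zero; suc; _<_; _∸_; _≤ᵇ_; z≤n; s≤s; _≤?_)
import Data.Nat.Properties as ℕ
open import Data.Nat.Combinatorics using (nC1≡n; nCk+nC[k+1]≡[n+1]C[k+1]; nCn≡1; k>n⇒nCk≡0)
  renaming (_C_ to _choose_)
open import Data.Nat.Coprimality using (Coprime; coprime-divisor)
open import Data.Nat.DivMod as ℕ using ()
open import Data.Nat.Divisibility using (_∣?_; divides; m∣m*n; n∣m*n; ∣⇒≤; ∣-refl; ∣-trans; ∣m∣n⇒∣m+n)
open import Data.Nat.GeneralisedArithmetic using (fold; fold-+)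
open import Data.Nat.Induction using (<-rec)
open import Data.Nat.ListAction using (sum)
open import Data.Nat.Primality using (prime[2]; euclidsLemma; prime⇒irreducible; prime⇒nonZero)
open import Data.Nat.Tactic.RingSolver renaming (solve-∀ to ℕ-solve-∀)
open import Data.Product using (_,_)
open import Data.Sum using (inj₁; inj₂)
open import Data.Unit using (tt)
open import Function using (id; _∘_)
open import Function.Bundles using (mk⇔)
open import Level using (0ℓ)
open import Relation.Binary.Bundles using (Setoid)
open import Relation.Binary.Definitions using (Tri; tri<; tri≈; tri>)
open import Relation.Binary.PropositionalEquality
  using (refl; sym; trans; cong; cong₂; subst; subst₂; module ≡-Reasoning)
import Relation.Binary.Reasoning.Setoid as SetoidReasoning
open import Relation.Nullary using (yes; no; does; ¬?)
open import Relation.Nullary.Decidable using (dec-true; dec-false; does-⇔)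
open import Relation.Unary using (Pred; Decidable)

∑ : ℕ → (ℕ → ℤ) → ℤ
∑ zero    g = 0ℤ
∑ (suc n) g = g 0 + ∑ n (g ∘ suc)

infix 7 ∑
syntax ∑ n (λ i → e) = ∑[ i < n ] e

∑-cong : ∀ n {g h : ℕ → ℤ} → (∀ i → i < n → g i ≡ h i) → ∑ n g ≡ ∑ n h
∑-cong zero    e = refl
∑-cong (suc n) e = cong₂ _+_ (e 0 (s≤s z≤n)) (∑-cong n (λ i i<n → e (suc i) (s≤s i<n)))

∑-zero : ∀ n {g : ℕ → ℤ} → (∀ i → i < n → g i ≡ 0ℤ) → ∑ n g ≡ 0ℤ
∑-zero zero    e = refl
∑-zero (suc n) e = cong₂ _+_ (e 0 (s≤s z≤n)) (∑-zero n (λ i i<n → e (suc i) (s≤s i<n)))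

∑-+ : ∀ n (g h : ℕ → ℤ) → ∑[ i < n ] (g i + h i) ≡ ∑ n g + ∑ n h
∑-+ zero    g h = refl
∑-+ (suc n) g h = trans (cong (_+_ (g 0 + h 0)) (∑-+ n (g ∘ suc) (h ∘ suc)))
                        (interchange (g 0) (h 0) (∑ n (g ∘ suc)) (∑ n (h ∘ suc)))
  where interchange : ∀ a b c d → (a + b) + (c + d) ≡ (a + c) + (b + d)
        interchange = solve-∀

∑-neg : ∀ n (g : ℕ → ℤ) → ∑[ i < n ] (- g i) ≡ - ∑ n g
∑-neg zero    g = refl
∑-neg (suc n) g = trans (cong (_+_ (- g 0)) (∑-neg n (g ∘ suc)))
                        (sym (ℤ.neg-distrib-+ (g 0) (∑ n (g ∘ suc))))

∑-split : ∀ m n (g : ℕ → ℤ) → ∑ (m ℕ.+ n) g ≡ ∑ m g + ∑[ i < n ] g (m ℕ.+ i)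
∑-split zero    n g = sym (ℤ.+-identityˡ _)
∑-split (suc m) n g = trans (cong (_+_ (g 0)) (∑-split m n (g ∘ suc))) (sym (ℤ.+-assoc (g 0) _ _))

∑-suc : ∀ n (g : ℕ → ℤ) → ∑ (suc n) g ≡ ∑ n g + g n
∑-suc n g = begin
  ∑ (suc n) g                     ≡⟨ cong (λ k → ∑ k g) (ℕ.+-comm 1 n) ⟩
  ∑ (n ℕ.+ 1) g                   ≡⟨ ∑-split n 1 g ⟩
  ∑ n g + (g (n ℕ.+ 0) + 0ℤ)      ≡⟨ cong (_+_ (∑ n g)) (trans (ℤ.+-identityʳ _) (cong g (ℕ.+-identityʳ n))) ⟩
  ∑ n g + g n                     ∎
  where open ≡-Reasoning

∑-vanishing-tail : ∀ {m n} (g : ℕ → ℤ) → m ≤ n → (∀ i → m ≤ i → i < n → g i ≡ 0ℤ) → ∑ n g ≡ ∑ m g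
∑-vanishing-tail {m} {n} g m≤n e = begin
  ∑ n g                                   ≡⟨ cong (λ k → ∑ k g) (sym (ℕ.m+[n∸m]≡n m≤n)) ⟩
  ∑ (m ℕ.+ (n ∸ m)) g                     ≡⟨ ∑-split m (n ∸ m) g ⟩
  ∑ m g + ∑[ i < n ∸ m ] g (m ℕ.+ i)      ≡⟨ cong (_+_ (∑ m g)) (∑-zero (n ∸ m) tail-vanishes) ⟩
  ∑ m g + 0ℤ                              ≡⟨ ℤ.+-identityʳ _ ⟩
  ∑ m g                                   ∎
  where
  open ≡-Reasoning
  tail-vanishes : ∀ i → i < n ∸ m → g (m ℕ.+ i) ≡ 0ℤ
  tail-vanishes i i<n∸m =
    e (m ℕ.+ i) (ℕ.m≤m+n m i) (ℕ.<-≤-trans (ℕ.+-monoʳ-< m i<n∸m) (ℕ.≤-reflexive (ℕ.m+[n∸m]≡n m≤n)))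

sum-map-upTo : ∀ n (g : ℕ → ℕ) → + sum (map g (upTo n)) ≡ ∑[ i < n ] + g i
sum-map-upTo n g = go n id
  where
  go : ∀ n (f : ℕ → ℕ) → + sum (map g (applyUpTo f n)) ≡ ∑[ i < n ] + g (f i)
  go zero    f = refl
  go (suc n) f = trans (ℤ.pos-+ (g (f 0)) _) (cong (_+_ (+ g (f 0))) (go n (f ∘ suc)))

-- A series is its sequence of coefficients; an `Op` stands for multiplication by a fixed
-- series: `shift t` by q^t, `dilatedMul s c` by c(q^s), `geometric s` by 1/(1 - q^s).
Series : Set
Series = ℕ → ℤ

Op : Set
Op = Series → Series

δ : Series
δ zero    = 1ℤ
δ (suc _) = 0ℤ

δ-pos : ∀ {i} → 1 ≤ i → δ i ≡ 0ℤ
δ-pos {suc i} _ = refl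

shift : ℕ → Op
shift t f n = if t ≤ᵇ n then f (n ∸ t) else 0ℤ

dilatedMul : ℕ → Series → Op
dilatedMul s c f n = ∑[ i < suc n ] (c i * shift (i ℕ.* s) f n)

oneMinus onePlus geometric : ℕ → Op
oneMinus  s f n = f n - shift s f n
onePlus   s f n = f n + shift s f n
geometric s     = dilatedMul s (λ _ → 1ℤ)

shift-≤ : ∀ {t n} f → t ≤ n → shift t f n ≡ f (n ∸ t)
shift-≤ {t} {n} f t≤n with t ≤ᵇ n | ℕ.≤⇒≤ᵇ t≤n
... | true | _ = refl

shift-> : ∀ {t n} f → n < t → shift t f n ≡ 0ℤ
shift-> {t} {n} f n<t with t ≤ᵇ n | ℕ.≤ᵇ⇒≤ t n
... | false | _   = refl
... | true  | t≤n = ⊥-elim (ℕ.<⇒≱ n<t (t≤n tt))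

shift-shift : ∀ a b f n → shift a (shift b f) n ≡ shift (a ℕ.+ b) f n
shift-shift a b f n with a ≤? n
... | no a≰n = trans (shift-> (shift b f) (ℕ.≰⇒> a≰n))
                     (sym (shift-> f (ℕ.<-≤-trans (ℕ.≰⇒> a≰n) (ℕ.m≤m+n a b))))
... | yes a≤n with b ≤? n ∸ a
...   | yes b≤n∸a = begin
  shift a (shift b f) n   ≡⟨ shift-≤ (shift b f) a≤n ⟩
  shift b f (n ∸ a)       ≡⟨ shift-≤ f b≤n∸a ⟩
  f (n ∸ a ∸ b)           ≡⟨ cong f (ℕ.∸-+-assoc n a b) ⟩
  f (n ∸ (a ℕ.+ b))       ≡⟨ shift-≤ f a+b≤n ⟨
  shift (a ℕ.+ b) f n     ∎
  where
  open ≡-Reasoning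
  a+b≤n : a ℕ.+ b ≤ n
  a+b≤n = ℕ.≤-trans (ℕ.+-monoʳ-≤ a b≤n∸a) (ℕ.≤-reflexive (ℕ.m+[n∸m]≡n a≤n))
...   | no b≰n∸a = trans (shift-≤ (shift b f) a≤n)
                         (trans (shift-> f (ℕ.≰⇒> b≰n∸a)) (sym (shift-> f n<a+b)))
  where
  n<a+b : n < a ℕ.+ b
  n<a+b = ℕ.<-≤-trans (ℕ.≤-reflexive (cong suc (sym (ℕ.m+[n∸m]≡n a≤n))))
                      (ℕ.≤-trans (ℕ.≤-reflexive (sym (ℕ.+-suc a (n ∸ a)))) (ℕ.+-monoʳ-≤ a (ℕ.≰⇒> b≰n∸a)))

shift-+ : ∀ t f g n → shift t (λ j → f j + g j) n ≡ shift t f n + shift t g n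
shift-+ t f g n with t ≤ᵇ n
... | true  = refl
... | false = refl

shift-neg : ∀ t f n → shift t (λ j → - f j) n ≡ - shift t f n
shift-neg t f n with t ≤ᵇ n
... | true  = refl
... | false = refl

shift-cong : ∀ t {f g : Series} n → (∀ j → j ≤ n → f j ≡ g j) → shift t f n ≡ shift t g n
shift-cong t {f} {g} n e with t ≤? n
... | yes t≤n = trans (shift-≤ f t≤n) (trans (e (n ∸ t) (ℕ.m∸n≤m n t)) (sym (shift-≤ g t≤n)))
... | no  t≰n = trans (shift-> f (ℕ.≰⇒> t≰n)) (sym (shift-> g (ℕ.≰⇒> t≰n)))

i≤i*s : ∀ i {s} → 1 ≤ s → i ≤ i ℕ.* s
i≤i*s i {suc s} _ = ℕ.m≤m*n i (suc s)

dilatedMul-coeff-cong : ∀ s {c e : Series} f n → (∀ i → c i ≡ e i) → dilatedMul s c f n ≡ dilatedMul s e f n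
dilatedMul-coeff-cong s f n e = ∑-cong (suc n) (λ i _ → cong (_* shift (i ℕ.* s) f n) (e i))

dilatedMul-coeff-sub : ∀ s c e f n →
  dilatedMul s (λ i → c i - e i) f n ≡ dilatedMul s c f n - dilatedMul s e f n
dilatedMul-coeff-sub s c e f n = begin
  ∑[ i < suc n ] ((c i - e i) * X i)               ≡⟨ ∑-cong (suc n) (λ i _ → distrib (c i) (e i) (X i)) ⟩
  ∑[ i < suc n ] (c i * X i + - (e i * X i))       ≡⟨ ∑-+ (suc n) (λ i → c i * X i) (λ i → - (e i * X i)) ⟩
  dilatedMul s c f n + ∑[ i < suc n ] (- (e i * X i)) ≡⟨ cong (_+_ (dilatedMul s c f n)) (∑-neg (suc n) (λ i → e i * X i)) ⟩
  dilatedMul s c f n - dilatedMul s e f n          ∎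
  where
  open ≡-Reasoning
  X : ℕ → ℤ
  X i = shift (i ℕ.* s) f n
  distrib : ∀ a b x → (a - b) * x ≡ a * x + - (b * x)
  distrib = solve-∀

dilatedMul-+ : ∀ s c f g n → dilatedMul s c (λ j → f j + g j) n ≡ dilatedMul s c f n + dilatedMul s c g n
dilatedMul-+ s c f g n =
  trans (∑-cong (suc n) (λ i _ → trans (cong (c i *_) (shift-+ (i ℕ.* s) f g n))
                                       (ℤ.*-distribˡ-+ (c i) (shift (i ℕ.* s) f n) (shift (i ℕ.* s) g n))))
        (∑-+ (suc n) (λ i → c i * shift (i ℕ.* s) f n) (λ i → c i * shift (i ℕ.* s) g n))

dilatedMul-neg : ∀ s c f n → dilatedMul s c (λ j → - f j) n ≡ - dilatedMul s c f n
dilatedMul-neg s c f n =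
  trans (∑-cong (suc n) (λ i _ → trans (cong (c i *_) (shift-neg (i ℕ.* s) f n))
                                       (sym (ℤ.neg-distribʳ-* (c i) (shift (i ℕ.* s) f n)))))
        (∑-neg (suc n) (λ i → c i * shift (i ℕ.* s) f n))

dilatedMul-δ : ∀ s f n → dilatedMul s δ f n ≡ f n
dilatedMul-δ s f n = trans (cong₂ _+_ (ℤ.*-identityˡ (f n)) (∑-zero n (λ _ _ → refl))) (ℤ.+-identityʳ (f n))

dilatedMul-shift : ∀ s c b f n → 1 ≤ s → dilatedMul s c (shift b f) n ≡ shift b (dilatedMul s c f) n
dilatedMul-shift s c b f n 1≤s with b ≤? n
... | no b≰n = trans (∑-zero (suc n) (λ i _ → trans (cong (c i *_) (trans (shift-shift (i ℕ.* s) b f n)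
                       (shift-> f (ℕ.<-≤-trans (ℕ.≰⇒> b≰n) (ℕ.m≤n+m b (i ℕ.* s)))))) (ℤ.*-zeroʳ (c i))))
                     (sym (shift-> (dilatedMul s c f) (ℕ.≰⇒> b≰n)))
... | yes b≤n = begin
  dilatedMul s c (shift b f) n                       ≡⟨ ∑-cong (suc n) (λ i _ → cong (c i *_) (shift-shift (i ℕ.* s) b f n)) ⟩
  ∑[ i < suc n ] X i                                 ≡⟨ ∑-vanishing-tail X (s≤s (ℕ.m∸n≤m n b)) (λ i n-b<i _ →
                                                          trans (cong (c i *_) (shift-> f (beyond i n-b<i))) (ℤ.*-zeroʳ (c i))) ⟩
  ∑[ i < suc (n ∸ b) ] X i                           ≡⟨ ∑-cong (suc (n ∸ b)) (λ i _ → cong (c i *_) (shift-swap i)) ⟨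
  dilatedMul s c f (n ∸ b)                           ≡⟨ shift-≤ (dilatedMul s c f) b≤n ⟨
  shift b (dilatedMul s c f) n                       ∎
  where
  open ≡-Reasoning
  X : ℕ → ℤ
  X i = c i * shift (i ℕ.* s ℕ.+ b) f n
  beyond : ∀ i → suc (n ∸ b) ≤ i → n < i ℕ.* s ℕ.+ b
  beyond i n-b<i = ℕ.≤-trans (ℕ.≤-reflexive (cong suc (sym (ℕ.m∸n+n≡m b≤n))))
                             (ℕ.+-monoˡ-≤ b (ℕ.≤-trans n-b<i (i≤i*s i 1≤s)))
  shift-swap : ∀ i → shift (i ℕ.* s) f (n ∸ b) ≡ shift (i ℕ.* s ℕ.+ b) f n
  shift-swap i = trans (sym (shift-≤ (shift (i ℕ.* s) f) b≤n))
                       (trans (shift-shift b (i ℕ.* s) f n) (cong (λ t → shift t f n) (ℕ.+-comm b (i ℕ.* s))))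

dilatedMul-shift1ˡ : ∀ s c f n → 1 ≤ s → dilatedMul s (shift 1 c) f n ≡ shift s (dilatedMul s c f) n
dilatedMul-shift1ˡ s c f n 1≤s = begin
  0ℤ * X 0 + ∑[ i < n ] (c i * X (suc i))          ≡⟨ ℤ.+-identityˡ _ ⟩
  ∑[ i < n ] (c i * X (suc i))                     ≡⟨ ℤ.+-identityʳ _ ⟨
  ∑[ i < n ] (c i * X (suc i)) + 0ℤ                ≡⟨ cong (_+_ (∑[ i < n ] (c i * X (suc i)))) last-vanishes ⟨
  ∑[ i < n ] (c i * X (suc i)) + c n * X (suc n)   ≡⟨ ∑-suc n (λ i → c i * X (suc i)) ⟨
  ∑[ i < suc n ] (c i * X (suc i))                 ≡⟨ ∑-cong (suc n) (λ i _ → cong (c i *_) (shifts-merge i)) ⟨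
  dilatedMul s c (shift s f) n                     ≡⟨ dilatedMul-shift s c s f n 1≤s ⟩
  shift s (dilatedMul s c f) n                     ∎
  where
  open ≡-Reasoning
  X : ℕ → ℤ
  X i = shift (i ℕ.* s) f n
  last-vanishes : c n * X (suc n) ≡ 0ℤ
  last-vanishes = trans (cong (c n *_) (shift-> f (ℕ.<-≤-trans (ℕ.n<1+n n) (i≤i*s (suc n) 1≤s))))
                        (ℤ.*-zeroʳ (c n))
  shifts-merge : ∀ i → shift (i ℕ.* s) (shift s f) n ≡ X (suc i)
  shifts-merge i = trans (shift-shift (i ℕ.* s) s f n) (cong (λ t → shift t f n) (ℕ.+-comm (i ℕ.* s) s))

dilatedMul-shiftˡ : ∀ s t c f n → 1 ≤ s → dilatedMul s (shift t c) f n ≡ shift (t ℕ.* s) (dilatedMul s c f) n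
dilatedMul-shiftˡ s zero    c f n 1≤s = refl
dilatedMul-shiftˡ s (suc t) c f n 1≤s = begin
  dilatedMul s (shift (suc t) c) f n               ≡⟨ dilatedMul-coeff-cong s f n (λ i → shift-shift 1 t c i) ⟨
  dilatedMul s (shift 1 (shift t c)) f n           ≡⟨ dilatedMul-shift1ˡ s (shift t c) f n 1≤s ⟩
  shift s (dilatedMul s (shift t c) f) n           ≡⟨ shift-cong s n (λ j _ → dilatedMul-shiftˡ s t c f j 1≤s) ⟩
  shift s (shift (t ℕ.* s) (dilatedMul s c f)) n   ≡⟨ shift-shift s (t ℕ.* s) (dilatedMul s c f) n ⟩
  shift (suc t ℕ.* s) (dilatedMul s c f) n         ∎
  where open ≡-Reasoning

oneMinus-dilatedMul : ∀ s c f n → 1 ≤ s → oneMinus s (dilatedMul s c f) n ≡ dilatedMul s (oneMinus 1 c) f n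
oneMinus-dilatedMul s c f n 1≤s = sym (begin
  dilatedMul s (oneMinus 1 c) f n                         ≡⟨ dilatedMul-coeff-sub s c (shift 1 c) f n ⟩
  dilatedMul s c f n - dilatedMul s (shift 1 c) f n       ≡⟨ cong (λ x → dilatedMul s c f n - x) (dilatedMul-shift1ˡ s c f n 1≤s) ⟩
  oneMinus s (dilatedMul s c f) n                         ∎)
  where open ≡-Reasoning

oneMinus-geometric : ∀ s f n → 1 ≤ s → oneMinus s (geometric s f) n ≡ f n
oneMinus-geometric s f n 1≤s =
  trans (oneMinus-dilatedMul s (λ _ → 1ℤ) f n 1≤s)
        (trans (dilatedMul-coeff-cong s f n first-difference) (dilatedMul-δ s f n))
  where
  first-difference : ∀ i → oneMinus 1 (λ _ → 1ℤ) i ≡ δ i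
  first-difference zero    = refl
  first-difference (suc i) = refl

oneMinus-dilatedMul-comm : ∀ b s c f n → 1 ≤ s → oneMinus b (dilatedMul s c f) n ≡ dilatedMul s c (oneMinus b f) n
oneMinus-dilatedMul-comm b s c f n 1≤s = begin
  dilatedMul s c f n - shift b (dilatedMul s c f) n    ≡⟨ cong (λ x → dilatedMul s c f n - x) (dilatedMul-shift s c b f n 1≤s) ⟨
  dilatedMul s c f n - dilatedMul s c (shift b f) n    ≡⟨ cong (_+_ (dilatedMul s c f n)) (dilatedMul-neg s c (shift b f) n) ⟨
  dilatedMul s c f n + dilatedMul s c (λ j → - shift b f j) n ≡⟨ dilatedMul-+ s c f (λ j → - shift b f j) n ⟨
  dilatedMul s c (oneMinus b f) n                      ∎
  where open ≡-Reasoning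

onePlus-dilatedMul-comm : ∀ b s c f n → 1 ≤ s → onePlus b (dilatedMul s c f) n ≡ dilatedMul s c (onePlus b f) n
onePlus-dilatedMul-comm b s c f n 1≤s =
  trans (cong (_+_ (dilatedMul s c f n)) (sym (dilatedMul-shift s c b f n 1≤s)))
        (sym (dilatedMul-+ s c f (shift b f) n))

conv : Series → Series → Series
conv f g n = ∑[ i < suc n ] (f i * g (n ∸ i))

conv-δ : ∀ g n → conv δ g n ≡ g n
conv-δ g n = trans (cong₂ _+_ (ℤ.*-identityˡ (g n)) (∑-zero n (λ _ _ → refl))) (ℤ.+-identityʳ (g n))

conv-shift : ∀ b f g n → conv (shift b f) g n ≡ shift b (conv f g) n
conv-shift b f g n with b ≤? n
... | no b≰n = trans (∑-zero (suc n) (λ i i≤n → cong (_* g (n ∸ i)) (shift-> f (ℕ.<-≤-trans i≤n (ℕ.≰⇒> b≰n)))))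
                     (sym (shift-> (conv f g) (ℕ.≰⇒> b≰n)))
... | yes b≤n = begin
  ∑ (suc n) X                                          ≡⟨ cong (λ k → ∑ k X) length ⟩
  ∑ (b ℕ.+ suc (n ∸ b)) X                              ≡⟨ ∑-split b (suc (n ∸ b)) X ⟩
  ∑ b X + ∑[ i < suc (n ∸ b) ] X (b ℕ.+ i)             ≡⟨ cong₂ _+_ (∑-zero b head-vanishes) (∑-cong (suc (n ∸ b)) unshift) ⟩
  0ℤ + conv f g (n ∸ b)                                ≡⟨ ℤ.+-identityˡ _ ⟩
  conv f g (n ∸ b)                                     ≡⟨ shift-≤ (conv f g) b≤n ⟨
  shift b (conv f g) n                                 ∎
  where
  open ≡-Reasoning
  X : ℕ → ℤ
  X i = shift b f i * g (n ∸ i)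
  length : suc n ≡ b ℕ.+ suc (n ∸ b)
  length = trans (cong suc (sym (ℕ.m+[n∸m]≡n b≤n))) (sym (ℕ.+-suc b (n ∸ b)))
  head-vanishes : ∀ i → i < b → X i ≡ 0ℤ
  head-vanishes i i<b = cong (_* g (n ∸ i)) (shift-> f i<b)
  unshift : ∀ i → i < suc (n ∸ b) → X (b ℕ.+ i) ≡ f i * g (n ∸ b ∸ i)
  unshift i _ = cong₂ _*_ (trans (shift-≤ f (ℕ.m≤m+n b i)) (cong f (ℕ.m+n∸m≡n b i)))
                          (cong g (sym (ℕ.∸-+-assoc n b i)))

conv-sub : ∀ f h g n → conv (λ j → f j - h j) g n ≡ conv f g n - conv h g n
conv-sub f h g n = begin
  ∑[ i < suc n ] ((f i - h i) * g (n ∸ i))                     ≡⟨ ∑-cong (suc n) (λ i _ → distrib (f i) (h i) (g (n ∸ i))) ⟩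
  ∑[ i < suc n ] (f i * g (n ∸ i) + - (h i * g (n ∸ i)))       ≡⟨ ∑-+ (suc n) (λ i → f i * g (n ∸ i)) (λ i → - (h i * g (n ∸ i))) ⟩
  conv f g n + ∑[ i < suc n ] (- (h i * g (n ∸ i)))            ≡⟨ cong (_+_ (conv f g n)) (∑-neg (suc n) (λ i → h i * g (n ∸ i))) ⟩
  conv f g n - conv h g n                                      ∎
  where
  open ≡-Reasoning
  distrib : ∀ a b x → (a - b) * x ≡ a * x + - (b * x)
  distrib = solve-∀

oneMinus-conv-comm : ∀ s f g n → oneMinus s (conv f g) n ≡ conv (oneMinus s f) g n
oneMinus-conv-comm s f g n =
  sym (trans (conv-sub f (shift s f) g n) (cong (λ x → conv f g n - x) (conv-shift s f g n)))

-- Iterates and finite products of operators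

_^[_] : Op → ℕ → Op
(F ^[ j ]) f = fold f F j

when : Bool → Op → Op
when b F f = if b then F f else f

∏ : ℕ → (ℕ → Op) → Op
∏ zero    F f = f
∏ (suc N) F f = ∏ N F (F (suc N) f)

^[]-* : ∀ a b F f → (F ^[ a ℕ.* b ]) f ≡ ((F ^[ b ]) ^[ a ]) f
^[]-* zero    b F f = refl
^[]-* (suc a) b F f = trans (fold-+ f F b) (cong (F ^[ b ]) (^[]-* a b F f))

∏-≡ : ∀ N {F G : ℕ → Op} → (∀ k f → F (suc k) f ≡ G (suc k) f) → ∀ f → ∏ N F f ≡ ∏ N G f
∏-≡ zero    e f = refl
∏-≡ (suc N) {F} {G} e f = trans (cong (∏ N F) (e N f)) (∏-≡ N e (G (suc N) f))

∏-drop : ∀ r M {F : ℕ → Op} → (∀ k → M < k → k ≤ r ℕ.+ M → ∀ f → F k f ≡ f) →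
         ∀ f → ∏ (r ℕ.+ M) F f ≡ ∏ M F f
∏-drop zero    M e f = refl
∏-drop (suc r) M {F} e f =
  trans (cong (∏ (r ℕ.+ M) F) (e (suc (r ℕ.+ M)) (s≤s (ℕ.m≤n+m M r)) ℕ.≤-refl f))
        (∏-drop r M (λ k M<k k≤r+M → e k M<k (ℕ.m≤n⇒m≤1+n k≤r+M)) f)

_∣ᵇ_ : ℕ → ℕ → Bool
q ∣ᵇ k = does (q ∣? k)

_∤ᵇ_ : ℕ → ℕ → Bool
q ∤ᵇ k = does (¬? (q ∣? k))

¬∣-between-multiples : ∀ q M k → q ℕ.* M < k → k < q ℕ.* suc M → ¬ (q ∣ k)
¬∣-between-multiples q M k qM<k k<q[1+M] (divides j k≡jq) = ℕ.<⇒≱ M<j (ℕ.≤-pred j<1+M)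
  where
  k≡qj : k ≡ q ℕ.* j
  k≡qj = trans k≡jq (ℕ.*-comm j q)
  M<j : M < j
  M<j = ℕ.*-cancelˡ-< q M j (subst (q ℕ.* M <_) k≡qj qM<k)
  j<1+M : j < suc M
  j<1+M = ℕ.*-cancelˡ-< q j (suc M) (subst (_< q ℕ.* suc M) k≡qj k<q[1+M])

∏-multiples : ∀ q M (F : ℕ → Op) f → 1 ≤ q →
  ∏ (q ℕ.* M) (λ k → when (q ∣ᵇ k) (F k)) f ≡ ∏ M (λ k → F (q ℕ.* k)) f
∏-multiples q zero F f _ = cong (λ L → ∏ L (λ k → when (q ∣ᵇ k) (F k)) f) (ℕ.*-zeroʳ q)
∏-multiples q@(suc q′) (suc M) F f _ = begin
  ∏ (q ℕ.* suc M) F′ f                               ≡⟨ cong (λ L → ∏ L F′ f) (ℕ.*-suc q M) ⟩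
  ∏ (q′ ℕ.+ q ℕ.* M) F′ (F′ (suc (q′ ℕ.+ q ℕ.* M)) f) ≡⟨ cong (∏ (q′ ℕ.+ q ℕ.* M) F′) top-factor ⟩
  ∏ (q′ ℕ.+ q ℕ.* M) F′ (F (q ℕ.* suc M) f)          ≡⟨ ∏-drop q′ (q ℕ.* M) non-multiples _ ⟩
  ∏ (q ℕ.* M) F′ (F (q ℕ.* suc M) f)                 ≡⟨ ∏-multiples q M F _ (s≤s z≤n) ⟩
  ∏ (suc M) (λ k → F (q ℕ.* k)) f                    ∎
  where
  open ≡-Reasoning
  F′ : ℕ → Op
  F′ k = when (q ∣ᵇ k) (F k)
  top-factor : F′ (suc (q′ ℕ.+ q ℕ.* M)) f ≡ F (q ℕ.* suc M) f
  top-factor = trans (cong (λ k → F′ k f) (sym (ℕ.*-suc q M)))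
                     (cong (λ b → when b (F (q ℕ.* suc M)) f) (dec-true (q ∣? q ℕ.* suc M) (m∣m*n (suc M))))
  non-multiples : ∀ k → q ℕ.* M < k → k ≤ q′ ℕ.+ q ℕ.* M → ∀ g → F′ k g ≡ g
  non-multiples k qM<k k≤ g = cong (λ b → when b (F k) g)
    (dec-false (q ∣? k) (¬∣-between-multiples q M k qM<k (subst (k <_) (sym (ℕ.*-suc q M)) (s≤s k≤))))

-- Binomial coefficients and divisibility

oneMinus-^[] : ∀ j s f n → 1 ≤ s → (oneMinus s ^[ j ]) f n ≡ dilatedMul s ((oneMinus 1 ^[ j ]) δ) f n
oneMinus-^[] zero    s f n 1≤s = sym (dilatedMul-δ s f n)
oneMinus-^[] (suc j) s f n 1≤s =
  trans (cong₂ _-_ (oneMinus-^[] j s f n 1≤s) (shift-cong s n (λ i _ → oneMinus-^[] j s f i 1≤s)))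
        (oneMinus-dilatedMul s ((oneMinus 1 ^[ j ]) δ) f n 1≤s)

oneMinus-power-coeff : ∀ j i → (oneMinus 1 ^[ j ]) δ i ≡ (-1ℤ ℤ.^ i) * + (j choose i)
oneMinus-power-coeff zero    zero    = refl
oneMinus-power-coeff zero    (suc i) = sym (ℤ.*-zeroʳ (-1ℤ ℤ.^ suc i))
oneMinus-power-coeff (suc j) zero    = trans (ℤ.+-identityʳ _) (oneMinus-power-coeff j zero)
oneMinus-power-coeff (suc j) (suc i) = begin
  (oneMinus 1 ^[ j ]) δ (suc i) - (oneMinus 1 ^[ j ]) δ i
    ≡⟨ cong₂ _-_ (oneMinus-power-coeff j (suc i)) (oneMinus-power-coeff j i) ⟩
  (-1ℤ * u) * + (j choose suc i) - u * + (j choose i)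
    ≡⟨ pascal-step u (+ (j choose i)) (+ (j choose suc i)) ⟩
  (-1ℤ * u) * (+ (j choose i) + + (j choose suc i))
    ≡⟨ cong (λ x → (-1ℤ * u) * x) (trans (sym (ℤ.pos-+ (j choose i) (j choose suc i))) (cong +_ (nCk+nC[k+1]≡[n+1]C[k+1] j i))) ⟩
  (-1ℤ * u) * + (suc j choose suc i)
    ∎
  where
  open ≡-Reasoning
  u = -1ℤ ℤ.^ i
  pascal-step : ∀ u a b → (-1ℤ * u) * b - u * a ≡ (-1ℤ * u) * (a + b)
  pascal-step = solve-∀

[1+k]*[1+n]C[1+k]≡[1+n]*nCk : ∀ n k → suc k ℕ.* (suc n choose suc k) ≡ suc n ℕ.* (n choose k)
[1+k]*[1+n]C[1+k]≡[1+n]*nCk zero    zero    = refl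
[1+k]*[1+n]C[1+k]≡[1+n]*nCk zero    (suc k) = ℕ.*-zeroʳ (suc (suc k))
[1+k]*[1+n]C[1+k]≡[1+n]*nCk (suc n) zero    =
  trans (ℕ.*-identityˡ _) (trans (nC1≡n (suc (suc n))) (sym (ℕ.*-identityʳ (suc (suc n)))))
[1+k]*[1+n]C[1+k]≡[1+n]*nCk (suc n) (suc k) = begin
  suc (suc k) ℕ.* (suc (suc n) choose suc (suc k))
    ≡⟨ cong (suc (suc k) ℕ.*_) (nCk+nC[k+1]≡[n+1]C[k+1] (suc n) (suc k)) ⟨
  suc (suc k) ℕ.* (a ℕ.+ b)
    ≡⟨ expand k a b ⟩
  a ℕ.+ suc k ℕ.* a ℕ.+ suc (suc k) ℕ.* b
    ≡⟨ cong₂ (λ x y → a ℕ.+ x ℕ.+ y) ([1+k]*[1+n]C[1+k]≡[1+n]*nCk n k) ([1+k]*[1+n]C[1+k]≡[1+n]*nCk n (suc k)) ⟩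
  a ℕ.+ suc n ℕ.* (n choose k) ℕ.+ suc n ℕ.* (n choose suc k)
    ≡⟨ collect n a (n choose k) (n choose suc k) ⟩
  a ℕ.+ suc n ℕ.* (n choose k ℕ.+ n choose suc k)
    ≡⟨ cong (λ x → a ℕ.+ suc n ℕ.* x) (nCk+nC[k+1]≡[n+1]C[k+1] n k) ⟩
  suc (suc n) ℕ.* a
    ∎
  where
  open ≡-Reasoning
  a = suc n choose suc k
  b = suc n choose suc (suc k)
  expand : ∀ k a b → suc (suc k) ℕ.* (a ℕ.+ b) ≡ a ℕ.+ suc k ℕ.* a ℕ.+ suc (suc k) ℕ.* b
  expand = ℕ-solve-∀
  collect : ∀ n a x y → a ℕ.+ suc n ℕ.* x ℕ.+ suc n ℕ.* y ≡ a ℕ.+ suc n ℕ.* (x ℕ.+ y)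
  collect = ℕ-solve-∀

prime∣pCk : ∀ {p k} → Prime p → 0 < k → k < p → p ∣ p choose k
prime∣pCk {suc n} {suc k} p-prime _ k<p
  with euclidsLemma (suc k) (suc n choose suc k) p-prime
         (divides (n choose k) (trans ([1+k]*[1+n]C[1+k]≡[1+n]*nCk n k) (ℕ.*-comm (suc n) (n choose k))))
... | inj₁ p∣1+k   = ⊥-elim (ℕ.<⇒≱ k<p (∣⇒≤ p∣1+k))
... | inj₂ p∣pC1+k = p∣pC1+k

-1^odd : ∀ n → ¬ (2 ∣ n) → -1ℤ ℤ.^ n ≡ -1ℤ
-1^odd zero          2∤0   = ⊥-elim (2∤0 (divides 0 refl))
-1^odd (suc zero)    _     = refl
-1^odd (suc (suc n)) 2∤2+n = trans (square (-1ℤ ℤ.^ n)) (-1^odd n (2∤2+n ∘ ∣m∣n⇒∣m+n ∣-refl))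
  where square : ∀ u → -1ℤ * (-1ℤ * u) ≡ u
        square = solve-∀

[m*n]^k≡m^k*n^k : ∀ m n k → (m ℕ.* n) ℕ.^ k ≡ m ℕ.^ k ℕ.* n ℕ.^ k
[m*n]^k≡m^k*n^k m n zero    = refl
[m*n]^k≡m^k*n^k m n (suc k) = trans (cong (m ℕ.* n ℕ.*_) ([m*n]^k≡m^k*n^k m n k)) (regroup m n (m ℕ.^ k) (n ℕ.^ k))
  where regroup : ∀ m n x y → m ℕ.* n ℕ.* (x ℕ.* y) ≡ m ℕ.* x ℕ.* (n ℕ.* y)
        regroup = ℕ-solve-∀

prime∤⇒coprime : ∀ {p q} → Prime p → ¬ (p ∣ q) → Coprime q p
prime∤⇒coprime p-prime p∤q (i∣q , i∣p) with prime⇒irreducible p-prime i∣p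
... | inj₁ i≡1 = i≡1
... | inj₂ refl = ⊥-elim (p∤q i∣q)

∤ᵇ-*ˡ : ∀ {q a} k → Coprime q a → q ∤ᵇ (a ℕ.* k) ≡ q ∤ᵇ k
∤ᵇ-*ˡ {q} {a} k q⊥a =
  cong not (does-⇔ (mk⇔ (coprime-divisor q⊥a) (λ q∣k → ∣-trans q∣k (n∣m*n a))) (q ∣? a ℕ.* k) (q ∣? k))

module Modulo (m : ℕ) where

  infix 4 _≈_
  record _≈_ (x y : ℤ) : Set where
    constructor witness
    field
      quotient : ℤ
      equation : x ≡ y + quotient * + m

  ≈-refl : ∀ {x} → x ≈ x
  ≈-refl {x} = witness 0ℤ (add-zero x (+ m))
    where add-zero : ∀ x M → x ≡ x + 0ℤ * M
          add-zero = solve-∀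

  ≡⇒≈ : ∀ {x y} → x ≡ y → x ≈ y
  ≡⇒≈ refl = ≈-refl

  ≈-sym : ∀ {x y} → x ≈ y → y ≈ x
  ≈-sym {y = y} (witness k x≡y+km) = witness (- k) (trans (undo y k (+ m)) (cong (_+ (- k) * + m) (sym x≡y+km)))
    where undo : ∀ y k M → y ≡ (y + k * M) + (- k) * M
          undo = solve-∀

  ≈-trans : ∀ {x y z} → x ≈ y → y ≈ z → x ≈ z
  ≈-trans {z = z} (witness k refl) (witness l refl) = witness (l + k) (merge z l k (+ m))
    where merge : ∀ z l k M → (z + l * M) + k * M ≡ z + (l + k) * M
          merge = solve-∀

  ≈-+ : ∀ {x x′ y y′} → x ≈ x′ → y ≈ y′ → x + y ≈ x′ + y′
  ≈-+ {x′ = x′} {y′ = y′} (witness k refl) (witness l refl) = witness (k + l) (collect x′ y′ k l (+ m))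
    where collect : ∀ a b k l M → (a + k * M) + (b + l * M) ≡ (a + b) + (k + l) * M
          collect = solve-∀

  ≈-neg : ∀ {x y} → x ≈ y → - x ≈ - y
  ≈-neg {y = y} (witness k refl) = witness (- k) (negate y k (+ m))
    where negate : ∀ a k M → - (a + k * M) ≡ - a + (- k) * M
          negate = solve-∀

  ≈-* : ∀ {x x′ y y′} → x ≈ x′ → y ≈ y′ → x * y ≈ x′ * y′
  ≈-* {x′ = x′} {y′ = y′} (witness k refl) (witness l refl) =
    witness (k * y′ + x′ * l + k * l * + m) (expand x′ y′ k l (+ m))
    where expand : ∀ a b k l M → (a + k * M) * (b + l * M) ≡ a * b + (k * b + a * l + k * l * M) * M
          expand = solve-∀

  ≈-cancelʳ : ∀ {a b c d} → a + b ≈ c + d → b ≈ d → a ≈ c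
  ≈-cancelʳ {a} {b} {c} {d} (witness k a+b≡) (witness l b≡) =
    witness (k - l) (trans (sym (add-sub a b)) (trans (cong₂ _-_ a+b≡ b≡) (subtract c d k l (+ m))))
    where add-sub : ∀ a b → a + b - b ≡ a
          add-sub = solve-∀
          subtract : ∀ c d k l M → c + d + k * M - (d + l * M) ≡ c + (k - l) * M
          subtract = solve-∀

  private
    %≡-witness : ∀ {x y} .{{_ : ℕ.NonZero m}} k → + x ≡ + y + + k * + m → x ℕ.% m ≡ y ℕ.% m
    %≡-witness {x} {y} k eq = trans (cong (ℕ._% m) (ℤ.+-injective (trans eq (cong (_+_ (+ y)) (sym (ℤ.pos-* k m))))))
                            (ℕ.[m+kn]%n≡m%n y k m)

  ≈0⇒∣ : ∀ {x} → + x ≈ 0ℤ → m ∣ x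
  ≈0⇒∣ (witness k x≡0+km) =
    divides ℤ.∣ k ∣ (trans (cong ℤ.∣_∣ (trans x≡0+km (ℤ.+-identityˡ (k * + m)))) (ℤ.∣i*j∣≡∣i∣*∣j∣ k (+ m)))

  ≈⇒%≡ : ∀ {x y} .{{_ : ℕ.NonZero m}} → + x ≈ + y → x ℕ.% m ≡ y ℕ.% m
  ≈⇒%≡ (witness (+ k) eq)             = %≡-witness k eq
  ≈⇒%≡ e@(witness ℤ.-[1+ k ] _)        = sym (%≡-witness (suc k) (_≈_.equation (≈-sym e)))

  multiple≈0 : ∀ a q → a * + (q ℕ.* m) ≈ 0ℤ
  multiple≈0 a q = witness (a * + q) (trans (cong (a *_) (ℤ.pos-* q m)) (reassociate a (+ q) (+ m)))
    where reassociate : ∀ a b c → a * (b * c) ≡ 0ℤ + a * b * c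
          reassociate = solve-∀

  ≈-setoid : Setoid 0ℓ 0ℓ
  ≈-setoid = record
    { Carrier       = ℤ
    ; _≈_           = _≈_
    ; isEquivalence = record { refl = ≈-refl ; sym = ≈-sym ; trans = ≈-trans }
    }

  module ≈-Reasoning = SetoidReasoning ≈-setoid

  ∑-≈ : ∀ n {g h : ℕ → ℤ} → (∀ i → i < n → g i ≈ h i) → ∑ n g ≈ ∑ n h
  ∑-≈ zero    e = ≈-refl
  ∑-≈ (suc n) e = ≈-+ (e 0 (s≤s z≤n)) (∑-≈ n (λ i i<n → e (suc i) (s≤s i<n)))

  infix 4 _≈[_]_
  _≈[_]_ : Series → ℕ → Series → Set
  f ≈[ n ] g = ∀ j → j ≤ n → f j ≈ g j

  ≈[]-refl : ∀ {f n} → f ≈[ n ] f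
  ≈[]-refl _ _ = ≈-refl

  ≈[]-sym : ∀ {f g n} → f ≈[ n ] g → g ≈[ n ] f
  ≈[]-sym e j j≤n = ≈-sym (e j j≤n)

  ≈[]-trans : ∀ {f g h n} → f ≈[ n ] g → g ≈[ n ] h → f ≈[ n ] h
  ≈[]-trans e e′ j j≤n = ≈-trans (e j j≤n) (e′ j j≤n)

  ≗⇒≈[] : ∀ {f g n} → (∀ j → f j ≡ g j) → f ≈[ n ] g
  ≗⇒≈[] e j _ = ≡⇒≈ (e j)

  ≈[]-setoid : ℕ → Setoid 0ℓ 0ℓ
  ≈[]-setoid n = record
    { Carrier       = Series
    ; _≈_           = _≈[ n ]_
    ; isEquivalence = record { refl = ≈[]-refl ; sym = ≈[]-sym ; trans = ≈[]-trans }
    }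

  module ≈[]-Reasoning (n : ℕ) = SetoidReasoning (≈[]-setoid n)

  Congruent Cancellative : Op → Set
  Congruent    F = ∀ {n f g} → f ≈[ n ] g → F f ≈[ n ] F g
  Cancellative F = ∀ {n f g} → F f ≈[ n ] F g → f ≈[ n ] g

  Commute : Op → Op → Set
  Commute F G = ∀ f n → F (G f) ≈[ n ] G (F f)

  TrivialUpTo : ℕ → Op → Set
  TrivialUpTo n F = ∀ f → F f ≈[ n ] f

  shift-≈ : ∀ t {f g : Series} n → (∀ j → j ≤ n → f j ≈ g j) → shift t f n ≈ shift t g n
  shift-≈ t {f} {g} n e with t ≤? n
  ... | yes t≤n = subst₂ _≈_ (sym (shift-≤ f t≤n)) (sym (shift-≤ g t≤n)) (e (n ∸ t) (ℕ.m∸n≤m n t))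
  ... | no  t≰n = ≡⇒≈ (trans (shift-> f (ℕ.≰⇒> t≰n)) (sym (shift-> g (ℕ.≰⇒> t≰n))))

  shift-≈-below : ∀ t {f g : Series} n → 1 ≤ t → (∀ j → j < n → f j ≈ g j) → shift t f n ≈ shift t g n
  shift-≈-below t {f} {g} n 1≤t e with t ≤? n
  ... | yes t≤n = subst₂ _≈_ (sym (shift-≤ f t≤n)) (sym (shift-≤ g t≤n)) (e (n ∸ t) (ℕ.∸-monoʳ-< 1≤t t≤n))
  ... | no  t≰n = ≡⇒≈ (trans (shift-> f (ℕ.≰⇒> t≰n)) (sym (shift-> g (ℕ.≰⇒> t≰n))))

  shift-congruent : ∀ t → Congruent (shift t)
  shift-congruent t e j j≤n = shift-≈ t j (λ i i≤j → e i (ℕ.≤-trans i≤j j≤n))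

  dilatedMul-congruent : ∀ s c → Congruent (dilatedMul s c)
  dilatedMul-congruent s c {f = f} {g} e j j≤n =
    ∑-≈ (suc j) {λ i → c i * shift (i ℕ.* s) f j} {λ i → c i * shift (i ℕ.* s) g j}
        (λ i _ → ≈-* (≈-refl {c i}) (shift-congruent (i ℕ.* s) e j j≤n))

  dilatedMul-coeff-≈ : ∀ s {c e : Series} f n → (∀ i → c i ≈ e i) → dilatedMul s c f n ≈ dilatedMul s e f n
  dilatedMul-coeff-≈ s {c} {c′} f n e =
    ∑-≈ (suc n) {λ i → c i * shift (i ℕ.* s) f n} {λ i → c′ i * shift (i ℕ.* s) f n}
        (λ i _ → ≈-* (e i) (≈-refl {shift (i ℕ.* s) f n}))

  geometric-congruent : ∀ s → Congruent (geometric s)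
  geometric-congruent s = dilatedMul-congruent s (λ _ → 1ℤ)

  oneMinus-congruent : ∀ s → Congruent (oneMinus s)
  oneMinus-congruent s e j j≤n = ≈-+ (e j j≤n) (≈-neg (shift-congruent s e j j≤n))

  onePlus-congruent : ∀ s → Congruent (onePlus s)
  onePlus-congruent s e j j≤n = ≈-+ (e j j≤n) (shift-congruent s e j j≤n)

  conv-congruentˡ : ∀ h → Congruent (λ f → conv f h)
  conv-congruentˡ h {f = f} {g} e j j≤n =
    ∑-≈ (suc j) {λ i → f i * h (j ∸ i)} {λ i → g i * h (j ∸ i)}
        (λ i i≤j → ≈-* (e i (ℕ.≤-trans (ℕ.≤-pred i≤j) j≤n)) (≈-refl {h (j ∸ i)}))

  unitriangular-cancellative :
    (K : Op) → (∀ n {f g} → (∀ i → i < n → f i ≈ g i) → K f n ≈ K g n) →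
    ∀ {f g} n → (∀ j → j ≤ n → f j + K f j ≈ g j + K g j) → f ≈[ n ] g
  unitriangular-cancellative K K-strictly-lower {f} {g} n e = <-rec (λ j → j ≤ n → f j ≈ g j) step
    where
    step : ∀ j → (∀ {i} → i < j → i ≤ n → f i ≈ g i) → j ≤ n → f j ≈ g j
    step j below j≤n = ≈-cancelʳ (e j j≤n)
      (K-strictly-lower j (λ i i<j → below i<j (ℕ.≤-trans (ℕ.<⇒≤ i<j) j≤n)))

  oneMinus-cancellative : ∀ s → 1 ≤ s → Cancellative (oneMinus s)
  oneMinus-cancellative s 1≤s {n} =
    unitriangular-cancellative (λ f j → - shift s f j) (λ j below → ≈-neg (shift-≈-below s j 1≤s below)) n

  oneMinus-geometric-≈ : ∀ s → 1 ≤ s → ∀ f n → oneMinus s (geometric s f) ≈[ n ] f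
  oneMinus-geometric-≈ s 1≤s f n = ≗⇒≈[] (λ j → oneMinus-geometric s f j 1≤s)

  geometric-cancellative : ∀ s → 1 ≤ s → Cancellative (geometric s)
  geometric-cancellative s 1≤s {n} {f} {g} e =
    ≈[]-trans (≈[]-sym (oneMinus-geometric-≈ s 1≤s f n))
              (≈[]-trans (oneMinus-congruent s e) (oneMinus-geometric-≈ s 1≤s g n))

  commute-sym : ∀ {F G} → Commute F G → Commute G F
  commute-sym c f n = ≈[]-sym (c f n)

  commute-by-left-inverse : ∀ {L F G} → Cancellative L → Congruent G →
    (∀ f n → L (F f) ≈[ n ] f) → Commute L G → Commute F G
  commute-by-left-inverse {L} {F} {G} L-cancel G-cong LF≈id L∘G f n = L-cancel (begin
    L (F (G f))    ≈⟨ LF≈id (G f) n ⟩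
    G f            ≈⟨ G-cong (LF≈id f n) ⟨
    G (L (F f))    ≈⟨ L∘G (F f) n ⟨
    L (G (F f))    ∎)
    where open ≈[]-Reasoning n

  oneMinus-geometric-commute : ∀ a b → 1 ≤ b → Commute (oneMinus a) (geometric b)
  oneMinus-geometric-commute a b 1≤b f n = ≗⇒≈[] (λ j → oneMinus-dilatedMul-comm a b (λ _ → 1ℤ) f j 1≤b)

  geometric-commute : ∀ a b → 1 ≤ a → 1 ≤ b → Commute (geometric a) (geometric b)
  geometric-commute a b 1≤a 1≤b =
    commute-by-left-inverse {oneMinus a} {geometric a} {geometric b}
      (oneMinus-cancellative a 1≤a) (geometric-congruent b) (oneMinus-geometric-≈ a 1≤a)
      (oneMinus-geometric-commute a b 1≤b)

  onePlus-geometric-commute : ∀ a b → 1 ≤ b → Commute (onePlus a) (geometric b)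
  onePlus-geometric-commute a b 1≤b f n = ≗⇒≈[] (λ j → onePlus-dilatedMul-comm a b (λ _ → 1ℤ) f j 1≤b)

  geometric-conv-commute : ∀ s h → 1 ≤ s → Commute (geometric s) (λ f → conv f h)
  geometric-conv-commute s h 1≤s =
    commute-by-left-inverse {oneMinus s} {geometric s} {λ f → conv f h}
      (oneMinus-cancellative s 1≤s) (conv-congruentˡ h) (oneMinus-geometric-≈ s 1≤s)
      (λ f n → ≗⇒≈[] (oneMinus-conv-comm s f h))

  geometric-trivial : ∀ t {n} → n < t → TrivialUpTo n (geometric t)
  geometric-trivial t n<t f j j≤n = ≡⇒≈ (trans (cong (_+_ (1ℤ * f j)) (∑-zero j (λ i _ →
    cong (1ℤ *_) (shift-> f (ℕ.<-≤-trans (ℕ.≤-<-trans j≤n n<t) (ℕ.m≤m+n t (i ℕ.* t)))))))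
    (trans (ℤ.+-identityʳ _) (ℤ.*-identityˡ (f j))))

  ^[]-congruent : ∀ j {F} → Congruent F → Congruent (F ^[ j ])
  ^[]-congruent zero    F-cong e = e
  ^[]-congruent (suc j) F-cong e = F-cong (^[]-congruent j F-cong e)

  ^[]-cong : ∀ j {F G} → Congruent F → (∀ f n → F f ≈[ n ] G f) → ∀ f n → (F ^[ j ]) f ≈[ n ] (G ^[ j ]) f
  ^[]-cong zero    F-cong F≈G f n = ≈[]-refl
  ^[]-cong (suc j) {F} {G} F-cong F≈G f n =
    ≈[]-trans (F-cong (^[]-cong j F-cong F≈G f n)) (F≈G ((G ^[ j ]) f) n)

  ^[]-commute : ∀ j {F G} → Congruent G → Commute F G → Commute F (G ^[ j ])
  ^[]-commute zero    G-cong F∘G f n = ≈[]-refl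
  ^[]-commute (suc j) {F} {G} G-cong F∘G f n =
    ≈[]-trans (F∘G ((G ^[ j ]) f) n) (G-cong (^[]-commute j G-cong F∘G f n))

  ^[]-cancellative : ∀ j {F} → Cancellative F → Cancellative (F ^[ j ])
  ^[]-cancellative zero    F-cancel e = e
  ^[]-cancellative (suc j) F-cancel e = ^[]-cancellative j F-cancel (F-cancel e)

  ^[]-trivial : ∀ j {n F} → TrivialUpTo n F → TrivialUpTo n (F ^[ j ])
  ^[]-trivial zero    F-trivial f = ≈[]-refl
  ^[]-trivial (suc j) {F = F} F-trivial f = ≈[]-trans (F-trivial ((F ^[ j ]) f)) (^[]-trivial j {F = F} F-trivial f)

  ^[]-left-inverse : ∀ j {L F} → Congruent L → Commute L F →
    (∀ f n → L (F f) ≈[ n ] f) → ∀ f n → (L ^[ j ]) ((F ^[ j ]) f) ≈[ n ] f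
  ^[]-left-inverse zero    L-cong L∘F LF≈id f n = ≈[]-refl
  ^[]-left-inverse (suc j) {L} {F} L-cong L∘F LF≈id f n = begin
    L ((L ^[ j ]) (F y))     ≈⟨ L-cong (^[]-commute j {F} {L} L-cong (commute-sym {L} {F} L∘F) y n) ⟨
    L (F ((L ^[ j ]) y))     ≈⟨ LF≈id ((L ^[ j ]) y) n ⟩
    (L ^[ j ]) y             ≈⟨ ^[]-left-inverse j L-cong L∘F LF≈id f n ⟩
    f                        ∎
    where
    open ≈[]-Reasoning n
    y = (F ^[ j ]) f

  when-congruent : ∀ b {F} → Congruent F → Congruent (when b F)
  when-congruent true  F-cong = F-cong
  when-congruent false F-cong e = e

  when-cancellative : ∀ b {F} → Cancellative F → Cancellative (when b F)
  when-cancellative true  F-cancel = F-cancel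
  when-cancellative false F-cancel e = e

  when-commuteˡ : ∀ b {F G} → Commute F G → Commute (when b F) G
  when-commuteˡ true  F∘G = F∘G
  when-commuteˡ false F∘G f n = ≈[]-refl

  when-commute : ∀ b b′ {F G} → Commute F G → Commute (when b F) (when b′ G)
  when-commute b b′ {F} {G} F∘G =
    when-commuteˡ b {F} {when b′ G} (commute-sym {when b′ G} {F} (when-commuteˡ b′ {G} {F} (commute-sym {F} {G} F∘G)))

  when-trivial : ∀ b {n F} → TrivialUpTo n F → TrivialUpTo n (when b F)
  when-trivial true  F-trivial = F-trivial
  when-trivial false F-trivial f = ≈[]-refl

  ∏-congruent : ∀ N {F} → (∀ k → Congruent (F k)) → Congruent (∏ N F)
  ∏-congruent zero    F-cong e = e
  ∏-congruent (suc N) F-cong e = ∏-congruent N F-cong (F-cong (suc N) e)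

  ∏-cong : ∀ N {F G} → (∀ k → Congruent (F k)) → (∀ k f n → F (suc k) f ≈[ n ] G (suc k) f) →
           ∀ f n → ∏ N F f ≈[ n ] ∏ N G f
  ∏-cong zero    F-cong F≈G f n = ≈[]-refl
  ∏-cong (suc N) {F} {G} F-cong F≈G f n =
    ≈[]-trans (∏-congruent N F-cong (F≈G N f n)) (∏-cong N F-cong F≈G (G (suc N) f) n)

  ∏-commute : ∀ N {F} X → (∀ k → Congruent (F k)) → (∀ k → Commute (F (suc k)) X) → Commute (∏ N F) X
  ∏-commute zero    X F-cong F∘X f n = ≈[]-refl
  ∏-commute (suc N) {F} X F-cong F∘X f n =
    ≈[]-trans (∏-congruent N F-cong (F∘X N f n)) (∏-commute N X F-cong F∘X (F (suc N) f) n)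

  ∏-merge : ∀ N {F G} → (∀ k → Congruent (F k)) → (∀ k → Congruent (G k)) →
            (∀ j k → Commute (G (suc j)) (F (suc k))) →
            ∀ f n → ∏ N F (∏ N G f) ≈[ n ] ∏ N (λ k → F k ∘ G k) f
  ∏-merge zero    F-cong G-cong G∘F f n = ≈[]-refl
  ∏-merge (suc N) {F} {G} F-cong G-cong G∘F f n =
    ≈[]-trans (∏-congruent N F-cong (≈[]-sym (∏-commute N (F (suc N)) G-cong (λ j → G∘F j N) (G (suc N) f) n)))
              (∏-merge N F-cong G-cong G∘F (F (suc N) (G (suc N) f)) n)

  ∏-∏-commute : ∀ M N {F G} → (∀ k → Congruent (F k)) → (∀ k → Congruent (G k)) →
                (∀ j k → Commute (F (suc j)) (G (suc k))) → Commute (∏ M F) (∏ N G)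
  ∏-∏-commute M N {F} {G} F-cong G-cong F∘G =
    ∏-commute M (∏ N G) F-cong (λ j → commute-sym {∏ N G} {F (suc j)}
      (∏-commute N (F (suc j)) G-cong (λ k → commute-sym {F (suc j)} {G (suc k)} (F∘G j k))))

  ∏-cancellative : ∀ N {F} → (∀ k → Cancellative (F (suc k))) → Cancellative (∏ N F)
  ∏-cancellative zero    F-cancel e = e
  ∏-cancellative (suc N) F-cancel e = F-cancel N (∏-cancellative N F-cancel e)

  ∏-truncate : ∀ {M N n F} → M ≤ N → (∀ k → Congruent (F k)) → (∀ k → M < k → TrivialUpTo n (F k)) →
               ∀ f → ∏ N F f ≈[ n ] ∏ M F f
  ∏-truncate {M} {N} {n} {F} M≤N F-cong F-trivial f =
    subst (λ L → ∏ L F f ≈[ n ] ∏ M F f) (ℕ.m∸n+n≡m M≤N) (drop (N ∸ M) f)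
    where
    drop : ∀ r f → ∏ (r ℕ.+ M) F f ≈[ n ] ∏ M F f
    drop zero    f = ≈[]-refl
    drop (suc r) f = ≈[]-trans (∏-congruent (r ℕ.+ M) F-cong (F-trivial (suc (r ℕ.+ M)) (s≤s (ℕ.m≤n+m M r)) f))
                               (drop r f)

  ∏-multiples-≈ : ∀ q n (F : ℕ → Op) f → 1 ≤ q → (∀ k → Congruent (F k)) → (∀ k → n < k → TrivialUpTo n (F k)) →
    ∏ n (λ k → when (q ∣ᵇ k) (F k)) f ≈[ n ] ∏ n (λ k → F (q ℕ.* k)) f
  ∏-multiples-≈ q@(suc q′) n F f 1≤q F-cong F-trivial = begin
    ∏ n F′ f                        ≡⟨ cong (λ L → ∏ L F′ f) n≡r+qM ⟩
    ∏ (r ℕ.+ q ℕ.* M) F′ f          ≡⟨ ∏-drop r (q ℕ.* M) non-multiples f ⟩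
    ∏ (q ℕ.* M) F′ f                ≡⟨ ∏-multiples q M F f 1≤q ⟩
    ∏ M (λ k → F (q ℕ.* k)) f       ≈⟨ ∏-truncate (ℕ.m/n≤m n q) (λ k → F-cong (q ℕ.* k)) large-multiples f ⟨
    ∏ n (λ k → F (q ℕ.* k)) f       ∎
    where
    open ≈[]-Reasoning n
    F′ : ℕ → Op
    F′ k = when (q ∣ᵇ k) (F k)
    M r : ℕ
    M = n ℕ./ q
    r = n ℕ.% q
    n≡r+qM : n ≡ r ℕ.+ q ℕ.* M
    n≡r+qM = trans (ℕ.m≡m%n+[m/n]*n n q) (cong (r ℕ.+_) (ℕ.*-comm M q))
    n<q[1+M] : n < q ℕ.* suc M
    n<q[1+M] = subst (n <_) (sym (ℕ.*-suc q M))
                 (subst (_< q ℕ.+ q ℕ.* M) (sym n≡r+qM) (ℕ.+-monoˡ-< (q ℕ.* M) (ℕ.m%n<n n q)))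
    non-multiples : ∀ k → q ℕ.* M < k → k ≤ r ℕ.+ q ℕ.* M → ∀ g → F′ k g ≡ g
    non-multiples k qM<k k≤ g = cong (λ b → when b (F k) g)
      (dec-false (q ∣? k) (¬∣-between-multiples q M k qM<k
        (ℕ.≤-<-trans (subst (k ≤_) (sym n≡r+qM) k≤) n<q[1+M])))
    large-multiples : ∀ k → M < k → TrivialUpTo n (F (q ℕ.* k))
    large-multiples k M<k = F-trivial (q ℕ.* k) (ℕ.<-≤-trans n<q[1+M] (ℕ.*-monoʳ-≤ q M<k))

module Frobenius {p : ℕ} (p-prime : Prime p) where
  open Modulo p

  1≤p : 1 ≤ p
  1≤p = ℕ.>-nonZero⁻¹ p {{prime⇒nonZero p-prime}}

  1≤p^_ : ∀ d → 1 ≤ p ℕ.^ d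
  1≤p^ d = ℕ.m^n>0 p {{prime⇒nonZero p-prime}} d

  -1^p≈-1 : -1ℤ ℤ.^ p ≈ -1ℤ
  -1^p≈-1 with 2 ∣? p
  ... | no  2∤p = ≡⇒≈ (-1^odd p 2∤p)
  ... | yes 2∣p with prime⇒irreducible p-prime 2∣p
  ...   | inj₁ ()
  ...   | inj₂ refl = witness 1ℤ refl

  frobenius-coeff : ∀ i → (oneMinus 1 ^[ p ]) δ i ≈ oneMinus p δ i
  frobenius-coeff i = ≈-trans (≡⇒≈ (oneMinus-power-coeff p i)) (by-position i (ℕ.<-cmp i p))
    where
    open ≈-Reasoning
    by-position : ∀ i → Tri (i < p) (i ≡ p) (p < i) → (-1ℤ ℤ.^ i) * + (p choose i) ≈ oneMinus p δ i
    by-position zero (tri< 0<p _ _) = ≡⇒≈ (sym (cong (λ x → 1ℤ - x) (shift-> δ 0<p)))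
    by-position i@(suc _) (tri< i<p _ _) with prime∣pCk p-prime (s≤s z≤n) i<p
    ... | divides q pCi≡qp = begin
      (-1ℤ ℤ.^ i) * + (p choose i)      ≡⟨ cong (λ x → (-1ℤ ℤ.^ i) * + x) pCi≡qp ⟩
      (-1ℤ ℤ.^ i) * + (q ℕ.* p)         ≈⟨ multiple≈0 (-1ℤ ℤ.^ i) q ⟩
      0ℤ                                ≡⟨ cong (λ x → 0ℤ - x) (shift-> δ i<p) ⟨
      oneMinus p δ i                    ∎
    by-position i (tri≈ _ refl _) = begin
      (-1ℤ ℤ.^ p) * + (p choose p)      ≡⟨ cong (λ x → (-1ℤ ℤ.^ p) * + x) (nCn≡1 p) ⟩
      (-1ℤ ℤ.^ p) * 1ℤ                  ≡⟨ ℤ.*-identityʳ (-1ℤ ℤ.^ p) ⟩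
      -1ℤ ℤ.^ p                         ≈⟨ -1^p≈-1 ⟩
      0ℤ - 1ℤ                           ≡⟨ cong₂ _-_ (δ-pos 1≤p) (trans (shift-≤ {p} δ ℕ.≤-refl) (cong δ (ℕ.n∸n≡0 p))) ⟨
      oneMinus p δ p                    ∎
    by-position i (tri> _ _ p<i) = begin
      (-1ℤ ℤ.^ i) * + (p choose i)      ≡⟨ cong (λ x → (-1ℤ ℤ.^ i) * + x) (k>n⇒nCk≡0 p<i) ⟩
      (-1ℤ ℤ.^ i) * 0ℤ                  ≡⟨ ℤ.*-zeroʳ (-1ℤ ℤ.^ i) ⟩
      0ℤ - 0ℤ                           ≡⟨ cong₂ _-_ (δ-pos (ℕ.<-trans 1≤p p<i))
                                                     (trans (shift-≤ δ (ℕ.<⇒≤ p<i)) (δ-pos (ℕ.m<n⇒0<n∸m p<i))) ⟨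
      oneMinus p δ i                    ∎

  oneMinus-frobenius : ∀ s f n → 1 ≤ s → (oneMinus s ^[ p ]) f ≈[ n ] oneMinus (p ℕ.* s) f
  oneMinus-frobenius s f n 1≤s j _ = begin
    (oneMinus s ^[ p ]) f j                              ≡⟨ oneMinus-^[] p s f j 1≤s ⟩
    dilatedMul s ((oneMinus 1 ^[ p ]) δ) f j             ≈⟨ dilatedMul-coeff-≈ s f j frobenius-coeff ⟩
    dilatedMul s (oneMinus p δ) f j                      ≡⟨ dilatedMul-coeff-sub s δ (shift p δ) f j ⟩
    dilatedMul s δ f j - dilatedMul s (shift p δ) f j    ≡⟨ cong₂ _-_ (dilatedMul-δ s f j) shifted ⟩
    oneMinus (p ℕ.* s) f j                               ∎
    where
    open ≈-Reasoning
    shifted : dilatedMul s (shift p δ) f j ≡ shift (p ℕ.* s) f j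
    shifted = trans (dilatedMul-shiftˡ s p δ f j 1≤s) (shift-cong (p ℕ.* s) j (λ i _ → dilatedMul-δ s f i))

  geometric-frobenius : ∀ s f n → 1 ≤ s → (geometric s ^[ p ]) f ≈[ n ] geometric (p ℕ.* s) f
  geometric-frobenius s f n 1≤s = oneMinus-cancellative (p ℕ.* s) 1≤ps (begin
    oneMinus (p ℕ.* s) ((geometric s ^[ p ]) f)       ≈⟨ oneMinus-frobenius s ((geometric s ^[ p ]) f) n 1≤s ⟨
    (oneMinus s ^[ p ]) ((geometric s ^[ p ]) f)      ≈⟨ ^[]-left-inverse p {oneMinus s} {geometric s} (oneMinus-congruent s)
                                                           (oneMinus-geometric-commute s s 1≤s) (oneMinus-geometric-≈ s 1≤s) f n ⟩
    f                                                 ≈⟨ oneMinus-geometric-≈ (p ℕ.* s) 1≤ps f n ⟨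
    oneMinus (p ℕ.* s) (geometric (p ℕ.* s) f)        ∎)
    where
    open ≈[]-Reasoning n
    1≤ps : 1 ≤ p ℕ.* s
    1≤ps = ℕ.*-mono-≤ 1≤p 1≤s

  geometric-frobenius-power : ∀ d s f n → 1 ≤ s → (geometric s ^[ p ℕ.^ d ]) f ≈[ n ] geometric (p ℕ.^ d ℕ.* s) f
  geometric-frobenius-power zero    s f n 1≤s = ≗⇒≈[] (λ j → cong (λ t → geometric t f j) (sym (ℕ.+-identityʳ s)))
  geometric-frobenius-power (suc d) s f n 1≤s = begin
    (geometric s ^[ p ℕ.* p ℕ.^ d ]) f                  ≡⟨ ^[]-* p (p ℕ.^ d) (geometric s) f ⟩
    ((geometric s ^[ p ℕ.^ d ]) ^[ p ]) f               ≈⟨ ^[]-cong p (^[]-congruent (p ℕ.^ d) (geometric-congruent s))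
                                                             (λ g m → geometric-frobenius-power d s g m 1≤s) f n ⟩
    (geometric (p ℕ.^ d ℕ.* s) ^[ p ]) f                ≈⟨ geometric-frobenius (p ℕ.^ d ℕ.* s) f n (ℕ.*-mono-≤ (1≤p^ d) 1≤s) ⟩
    geometric (p ℕ.* (p ℕ.^ d ℕ.* s)) f                 ≡⟨ cong (λ t → geometric t f) (ℕ.*-assoc p (p ℕ.^ d) s) ⟨
    geometric (p ℕ.* p ℕ.^ d ℕ.* s) f                   ∎
    where open ≈[]-Reasoning n

-- Partition counts as products of operators

∏ᴸ : (ℕ → Op) → List ℕ → Op
∏ᴸ O []       f = f
∏ᴸ O (x ∷ xs) f = O x (∏ᴸ O xs f)

countRep-∏ᴸ : ∀ L n → + countRep L n ≡ ∏ᴸ geometric L δ n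
countRep-∏ᴸ []       zero    = refl
countRep-∏ᴸ []       (suc n) = refl
countRep-∏ᴸ (s ∷ ss) n =
  trans (sum-map-upTo (suc n) _) (∑-cong (suc n) (λ i _ → trans (term i) (sym (ℤ.*-identityˡ _))))
  where
  term : ∀ i → + (if i ℕ.* s ≤ᵇ n then countRep ss (n ∸ i ℕ.* s) else 0) ≡ shift (i ℕ.* s) (∏ᴸ geometric ss δ) n
  term i with i ℕ.* s ≤ᵇ n
  ... | true  = countRep-∏ᴸ ss (n ∸ i ℕ.* s)
  ... | false = refl

countDist-∏ᴸ : ∀ L n → + countDist L n ≡ ∏ᴸ onePlus L δ n
countDist-∏ᴸ []       zero    = refl
countDist-∏ᴸ []       (suc n) = refl
countDist-∏ᴸ (s ∷ ss) n = trans (ℤ.pos-+ (countDist ss n) _) (cong₂ _+_ (countDist-∏ᴸ ss n) term)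
  where
  term : + (if s ≤ᵇ n then countDist ss (n ∸ s) else 0) ≡ shift s (∏ᴸ onePlus ss δ) n
  term with s ≤ᵇ n
  ... | true  = countDist-∏ᴸ ss (n ∸ s)
  ... | false = refl

∏ᴸ-++ : ∀ O xs ys f → ∏ᴸ O (xs ++ ys) f ≡ ∏ᴸ O xs (∏ᴸ O ys f)
∏ᴸ-++ O []       ys f = refl
∏ᴸ-++ O (x ∷ xs) ys f = cong (O x) (∏ᴸ-++ O xs ys f)

∏ᴸ-map : ∀ O (h : ℕ → ℕ) xs f → ∏ᴸ O (map h xs) f ≡ ∏ᴸ (O ∘ h) xs f
∏ᴸ-map O h []       f = refl
∏ᴸ-map O h (x ∷ xs) f = cong (O (h x)) (∏ᴸ-map O h xs f)

∏ᴸ-concatMap-replicate : ∀ O r (h : ℕ → ℕ) xs f →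
  ∏ᴸ O (concatMap (λ k → replicate r (h k)) xs) f ≡ ∏ᴸ (λ k → O (h k) ^[ r ]) xs f
∏ᴸ-concatMap-replicate O r h []       f = refl
∏ᴸ-concatMap-replicate O r h (x ∷ xs) f =
  trans (∏ᴸ-++ O (replicate r (h x)) _ f)
        (trans (replicate-factor r _) (cong (O (h x) ^[ r ]) (∏ᴸ-concatMap-replicate O r h xs f)))
  where
  replicate-factor : ∀ r g → ∏ᴸ O (replicate r (h x)) g ≡ (O (h x) ^[ r ]) g
  replicate-factor zero    g = refl
  replicate-factor (suc r) g = cong (O (h x)) (replicate-factor r g)

∏ᴸ-filter : ∀ {P : Pred ℕ 0ℓ} (P? : Decidable P) O xs f →
  ∏ᴸ O (filter P? xs) f ≡ ∏ᴸ (λ k → when (does (P? k)) (O k)) xs f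
∏ᴸ-filter P? O []       f = refl
∏ᴸ-filter P? O (x ∷ xs) f with does (P? x)
... | true  = cong (O x) (∏ᴸ-filter P? O xs f)
... | false = ∏ᴸ-filter P? O xs f

∏ᴸ-oneTo : ∀ O n f → ∏ᴸ O (oneTo n) f ≡ ∏ n O f
∏ᴸ-oneTo O n f = trans (cong (λ L → ∏ᴸ O L f) (List.map-applyUpTo id suc n)) (go n f)
  where
  go : ∀ n f → ∏ᴸ O (applyUpTo suc n) f ≡ ∏ n O f
  go zero    f = refl
  go (suc n) f = begin
    ∏ᴸ O (applyUpTo suc (suc n)) f               ≡⟨ cong (λ L → ∏ᴸ O L f) (List.applyUpTo-∷ʳ suc n) ⟨
    ∏ᴸ O (applyUpTo suc n ++ suc n ∷ []) f       ≡⟨ ∏ᴸ-++ O (applyUpTo suc n) (suc n ∷ []) f ⟩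
    ∏ᴸ O (applyUpTo suc n) (O (suc n) f)         ≡⟨ go n (O (suc n) f) ⟩
    ∏ (suc n) O f                                ∎
    where open ≡-Reasoning

module Factors (d p₁ p₂ : ℕ) where

  colours : ℕ
  colours = p₁ ℕ.^ d ∸ 1

  A-factor B-factor C-factor : ℕ → Op
  A-factor k = when (p₂ ∤ᵇ k) (when (p₁ ∤ᵇ k) (geometric (k ℕ.^ d)))
  B-factor k = when (p₂ ∤ᵇ k) (onePlus (k ℕ.^ d) ^[ colours ])
  C-factor k = when (p₂ ∤ᵇ k) (geometric (k ℕ.^ d) ^[ colours ])

  A-as-product : ∀ n → + A d p₁ p₂ n ≡ ∏ n A-factor δ n
  A-as-product n = trans (countRep-∏ᴸ (map (ℕ._^ d) bases) n) (cong (λ f → f n) (begin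
    ∏ᴸ geometric (map (ℕ._^ d) bases) δ
      ≡⟨ ∏ᴸ-map geometric (ℕ._^ d) bases δ ⟩
    ∏ᴸ (λ k → geometric (k ℕ.^ d)) (filter (λ k → ¬? (p₁ ∣? k)) (basesNotDiv p₂ n)) δ
      ≡⟨ ∏ᴸ-filter (λ k → ¬? (p₁ ∣? k)) _ (basesNotDiv p₂ n) δ ⟩
    ∏ᴸ (λ k → when (p₁ ∤ᵇ k) (geometric (k ℕ.^ d))) (basesNotDiv p₂ n) δ
      ≡⟨ ∏ᴸ-filter (λ k → ¬? (p₂ ∣? k)) _ (oneTo n) δ ⟩
    ∏ᴸ A-factor (oneTo n) δ
      ≡⟨ ∏ᴸ-oneTo A-factor n δ ⟩
    ∏ n A-factor δ
      ∎))
    where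
    open ≡-Reasoning
    bases = filter (λ k → ¬? (p₁ ∣? k)) (basesNotDiv p₂ n)

  coloured-as-product : ∀ (O : ℕ → Op) n →
    ∏ᴸ O (colouredParts d p₁ p₂ n) δ ≡ ∏ n (λ k → when (p₂ ∤ᵇ k) (O (k ℕ.^ d) ^[ colours ])) δ
  coloured-as-product O n = begin
    ∏ᴸ O (colouredParts d p₁ p₂ n) δ
      ≡⟨ ∏ᴸ-concatMap-replicate O colours (ℕ._^ d) (basesNotDiv p₂ n) δ ⟩
    ∏ᴸ (λ k → O (k ℕ.^ d) ^[ colours ]) (basesNotDiv p₂ n) δ
      ≡⟨ ∏ᴸ-filter (λ k → ¬? (p₂ ∣? k)) _ (oneTo n) δ ⟩
    ∏ᴸ (λ k → when (p₂ ∤ᵇ k) (O (k ℕ.^ d) ^[ colours ])) (oneTo n) δ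
      ≡⟨ ∏ᴸ-oneTo _ n δ ⟩
    ∏ n (λ k → when (p₂ ∤ᵇ k) (O (k ℕ.^ d) ^[ colours ])) δ
      ∎
    where open ≡-Reasoning

  B-as-product : ∀ n → + B d p₁ p₂ n ≡ ∏ n B-factor δ n
  B-as-product n = trans (countDist-∏ᴸ (colouredParts d p₁ p₂ n) n) (cong (λ f → f n) (coloured-as-product onePlus n))

  C-as-product : ∀ n → + C d p₁ p₂ n ≡ ∏ n C-factor δ n
  C-as-product n = trans (countRep-∏ᴸ (colouredParts d p₁ p₂ n) n) (cong (λ f → f n) (coloured-as-product geometric n))

module A·C≡1 {d p p₂ : ℕ} (1≤d : 1 ≤ d) (p-prime : Prime p) (p∤p₂ : ¬ (p ∣ p₂)) where
  open Modulo p
  open Frobenius p-prime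
  open Factors d p p₂

  G : ℕ → Op
  G k = geometric (k ℕ.^ d)

  1≤[1+k]^d : ∀ k → 1 ≤ suc k ℕ.^ d
  1≤[1+k]^d k = ℕ.m^n>0 (suc k) d

  G-congruent : ∀ k → Congruent (G k)
  G-congruent k = geometric-congruent (k ℕ.^ d)

  G-commute : ∀ j k → Commute (G (suc j)) (G (suc k))
  G-commute j k = geometric-commute (suc j ℕ.^ d) (suc k ℕ.^ d) (1≤[1+k]^d j) (1≤[1+k]^d k)

  G-trivial : ∀ {n} k → n < k → TrivialUpTo n (G k)
  G-trivial {n} k@(suc _) n<k = geometric-trivial (k ℕ.^ d) (ℕ.<-≤-trans n<k k≤k^d)
    where k≤k^d : k ≤ k ℕ.^ d
          k≤k^d = ℕ.≤-trans (ℕ.≤-reflexive (sym (ℕ.*-identityʳ k))) (ℕ.^-monoʳ-≤ k 1≤d)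

  A-congruent : ∀ k → Congruent (A-factor k)
  A-congruent k = when-congruent (p₂ ∤ᵇ k) (when-congruent (p ∤ᵇ k) (G-congruent k))

  C-congruent : ∀ k → Congruent (C-factor k)
  C-congruent k = when-congruent (p₂ ∤ᵇ k) (^[]-congruent colours (G-congruent k))

  A-trivial : ∀ {n} k → n < k → TrivialUpTo n (A-factor k)
  A-trivial k n<k = when-trivial (p₂ ∤ᵇ k) (when-trivial (p ∤ᵇ k) (G-trivial k n<k))

  C-trivial : ∀ {n} k → n < k → TrivialUpTo n (C-factor k)
  C-trivial k n<k = when-trivial (p₂ ∤ᵇ k) (^[]-trivial colours {F = G k} (G-trivial k n<k))

  C-cancellative : ∀ k → Cancellative (C-factor (suc k))
  C-cancellative k =
    when-cancellative (p₂ ∤ᵇ suc k) (^[]-cancellative colours (geometric-cancellative _ (1≤[1+k]^d k)))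

  A-C-commute : ∀ j k → Commute (A-factor (suc j)) (C-factor (suc k))
  A-C-commute j k =
    when-commute (p₂ ∤ᵇ suc j) (p₂ ∤ᵇ suc k) (when-commuteˡ (p ∤ᵇ suc j)
      (^[]-commute colours {G (suc j)} {G (suc k)} (G-congruent (suc k)) (G-commute j k)))

  P-factor W-factor : ℕ → Op
  P-factor k = when (p₂ ∤ᵇ k) (G k)
  W-factor k = when (p ∣ᵇ k) (P-factor k)

  P-congruent : ∀ k → Congruent (P-factor k)
  P-congruent k = when-congruent (p₂ ∤ᵇ k) (G-congruent k)

  W-congruent : ∀ k → Congruent (W-factor k)
  W-congruent k = when-congruent (p ∣ᵇ k) (P-congruent k)

  P-trivial : ∀ {n} k → n < k → TrivialUpTo n (P-factor k)
  P-trivial k n<k = when-trivial (p₂ ∤ᵇ k) (G-trivial k n<k)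

  W-cancellative : ∀ k → Cancellative (W-factor (suc k))
  W-cancellative k =
    when-cancellative (p ∣ᵇ suc k) (when-cancellative (p₂ ∤ᵇ suc k) (geometric-cancellative _ (1≤[1+k]^d k)))

  A-W-commute : ∀ j k → Commute (A-factor (suc j)) (W-factor (suc k))
  A-W-commute j k = when-commute (p₂ ∤ᵇ suc j) (p ∣ᵇ suc k)
    (when-commute (p ∤ᵇ suc j) (p₂ ∤ᵇ suc k) (G-commute j k))

  C-P-commute : ∀ j k → Commute (C-factor (suc j)) (P-factor (suc k))
  C-P-commute j k = when-commute (p₂ ∤ᵇ suc j) (p₂ ∤ᵇ suc k)
    (commute-sym {G (suc k)} {G (suc j) ^[ colours ]}
      (^[]-commute colours {G (suc k)} {G (suc j)} (G-congruent (suc j)) (G-commute k j)))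

  W∘A≡P : ∀ k h → W-factor k (A-factor k h) ≡ P-factor k h
  W∘A≡P k h with p ∣ᵇ k | p₂ ∤ᵇ k
  ... | true  | true  = refl
  ... | true  | false = refl
  ... | false | true  = refl
  ... | false | false = refl

  P∘C≈P[p*] : ∀ k h n → P-factor (suc k) (C-factor (suc k) h) ≈[ n ] when (p₂ ∤ᵇ suc k) (G (p ℕ.* suc k)) h
  P∘C≈P[p*] k h n with p₂ ∤ᵇ suc k
  ... | false = ≈[]-refl
  ... | true  = begin
    (G (suc k) ^[ suc colours ]) h                   ≡⟨ cong (λ e → (G (suc k) ^[ e ]) h) 1+colours≡p^d ⟩
    (G (suc k) ^[ p ℕ.^ d ]) h                       ≈⟨ geometric-frobenius-power d (suc k ℕ.^ d) h n (1≤[1+k]^d k) ⟩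
    geometric (p ℕ.^ d ℕ.* suc k ℕ.^ d) h            ≡⟨ cong (λ t → geometric t h) ([m*n]^k≡m^k*n^k p (suc k) d) ⟨
    G (p ℕ.* suc k) h                                ∎
    where
    open ≈[]-Reasoning n
    1+colours≡p^d : suc colours ≡ p ℕ.^ d
    1+colours≡p^d = trans (ℕ.+-comm 1 colours) (ℕ.m∸n+n≡m (1≤p^ d))

  A-factors-cancel-C-factors : ∀ n → ∏ n A-factor (∏ n C-factor δ) ≈[ n ] δ
  A-factors-cancel-C-factors n = ∏-cancellative n W-cancellative (begin
    ∏ n W-factor (∏ n A-factor c)                   ≈⟨ ∏-merge n W-congruent A-congruent A-W-commute c n ⟩
    ∏ n (λ k → W-factor k ∘ A-factor k) c           ≡⟨ ∏-≡ n (λ k → W∘A≡P (suc k)) c ⟩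
    ∏ n P-factor (∏ n C-factor δ)                   ≈⟨ ∏-merge n P-congruent C-congruent C-P-commute δ n ⟩
    ∏ n (λ k → P-factor k ∘ C-factor k) δ           ≈⟨ ∏-cong n (λ k → P-congruent k ∘ C-congruent k) P∘C≈P[p*] δ n ⟩
    ∏ n (λ k → when (p₂ ∤ᵇ k) (G (p ℕ.* k))) δ      ≡⟨ ∏-≡ n coprime-reindex δ ⟨
    ∏ n (λ k → P-factor (p ℕ.* k)) δ               ≈⟨ ∏-multiples-≈ p n P-factor δ 1≤p P-congruent P-trivial ⟨
    ∏ n W-factor δ                                  ∎)
    where
    open ≈[]-Reasoning n
    c = ∏ n C-factor δ
    coprime-reindex : ∀ k h → P-factor (p ℕ.* suc k) h ≡ when (p₂ ∤ᵇ suc k) (G (p ℕ.* suc k)) h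
    coprime-reindex k h =
      cong (λ b → when b (G (p ℕ.* suc k)) h) (∤ᵇ-*ˡ (suc k) (prime∤⇒coprime p-prime p∤p₂))

module _ {d p₂ : ℕ} (1≤d : 1 ≤ d) (2∤p₂ : ¬ (2 ∣ p₂)) where
  open Modulo 2
  open Factors d 2 p₂
  open A·C≡1 1≤d prime[2] 2∤p₂

  onePlus≈oneMinus : ∀ s f n → onePlus s f ≈[ n ] oneMinus s f
  onePlus≈oneMinus s f n j _ = witness (shift s f j) (add-twice (f j) (shift s f j))
    where add-twice : ∀ a x → a + x ≡ a - x + x * + 2
          add-twice = solve-∀

  U : ℕ → Op
  U k = onePlus (k ℕ.^ d)

  B-congruent : ∀ k → Congruent (B-factor k)
  B-congruent k = when-congruent (p₂ ∤ᵇ k) (^[]-congruent colours (onePlus-congruent (k ℕ.^ d)))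

  C-B-commute : ∀ j k → Commute (C-factor (suc j)) (B-factor (suc k))
  C-B-commute j k = when-commute (p₂ ∤ᵇ suc j) (p₂ ∤ᵇ suc k)
    (^[]-commute colours {G (suc j) ^[ colours ]} {U (suc k)} (onePlus-congruent (suc k ℕ.^ d))
      (commute-sym {U (suc k)} {G (suc j) ^[ colours ]}
        (^[]-commute colours {U (suc k)} {G (suc j)} (G-congruent (suc j))
          (onePlus-geometric-commute (suc k ℕ.^ d) (suc j ℕ.^ d) (1≤[1+k]^d j)))))

  B∘C-trivial : ∀ {n} k → TrivialUpTo n (B-factor (suc k) ∘ C-factor (suc k))
  B∘C-trivial {n} k h with p₂ ∤ᵇ suc k
  ... | false = ≈[]-refl
  ... | true  = ^[]-left-inverse colours {U (suc k)} {G (suc k)} (onePlus-congruent s)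
                  (onePlus-geometric-commute s s (1≤[1+k]^d k))
                  onePlus-geometric≈id h n
    where
    s = suc k ℕ.^ d
    onePlus-geometric≈id : ∀ f m → onePlus s (G (suc k) f) ≈[ m ] f
    onePlus-geometric≈id f m = ≈[]-trans (onePlus≈oneMinus s (G (suc k) f) m) (oneMinus-geometric-≈ s (1≤[1+k]^d k) f m)

  B-factors-cancel-C-factors : ∀ n → ∏ n B-factor (∏ n C-factor δ) ≈[ n ] δ
  B-factors-cancel-C-factors n = ≈[]-trans
    (∏-merge n B-congruent C-congruent C-B-commute δ n)
    (∏-truncate {N = n} z≤n (λ k → B-congruent k ∘ C-congruent k) (λ { (suc k) _ → B∘C-trivial k }) δ)

  A-factors≈B-factors : ∀ n → ∏ n A-factor δ ≈[ n ] ∏ n B-factor δ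
  A-factors≈B-factors n = ∏-cancellative n C-cancellative (begin
    ∏ n C-factor (∏ n A-factor δ)    ≈⟨ ∏-∏-commute n n C-congruent A-congruent C-A-commute δ n ⟩
    ∏ n A-factor (∏ n C-factor δ)    ≈⟨ A-factors-cancel-C-factors n ⟩
    δ                                ≈⟨ B-factors-cancel-C-factors n ⟨
    ∏ n B-factor (∏ n C-factor δ)    ≈⟨ ∏-∏-commute n n C-congruent B-congruent C-B-commute δ n ⟨
    ∏ n C-factor (∏ n B-factor δ)    ∎)
    where
    open ≈[]-Reasoning n
    C-A-commute : ∀ j k → Commute (C-factor (suc j)) (A-factor (suc k))
    C-A-commute j k = commute-sym {A-factor (suc k)} {C-factor (suc j)} (A-C-commute k j)

  A≡B-mod-2 : ∀ n → A d 2 p₂ n % 2 ≡ B d 2 p₂ n % 2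
  A≡B-mod-2 n = ≈⇒%≡ (begin
    + A d 2 p₂ n          ≡⟨ A-as-product n ⟩
    ∏ n A-factor δ n      ≈⟨ A-factors≈B-factors n n ℕ.≤-refl ⟩
    ∏ n B-factor δ n      ≡⟨ B-as-product n ⟨
    + B d 2 p₂ n          ∎)
    where open ≈-Reasoning

module _ {d p p₂ : ℕ} (1≤d : 1 ≤ d) (p-prime : Prime p) (p∤p₂ : ¬ (p ∣ p₂)) where
  open Modulo p
  open Factors d p p₂
  open A·C≡1 1≤d p-prime p∤p₂

  convAC≈conv : ∀ n → + convAC d p p₂ n ≈ conv (∏ n A-factor δ) (∏ n C-factor δ) n
  convAC≈conv n = ≈-trans (≡⇒≈ (sum-map-upTo (suc n) (λ i → A d p p₂ i ℕ.* C d p p₂ (n ∸ i))))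
    (∑-≈ (suc n) {λ i → + (A d p p₂ i ℕ.* C d p p₂ (n ∸ i))}
                 {λ i → ∏ n A-factor δ i * ∏ n C-factor δ (n ∸ i)} term)
    where
    open ≈-Reasoning
    term : ∀ i → i < suc n → + (A d p p₂ i ℕ.* C d p p₂ (n ∸ i)) ≈ ∏ n A-factor δ i * ∏ n C-factor δ (n ∸ i)
    term i i≤n = begin
      + (A d p p₂ i ℕ.* C d p p₂ (n ∸ i))          ≡⟨ ℤ.pos-* (A d p p₂ i) (C d p p₂ (n ∸ i)) ⟩
      + A d p p₂ i * + C d p p₂ (n ∸ i)           ≡⟨ cong₂ _*_ (A-as-product i) (C-as-product (n ∸ i)) ⟩
      ∏ i A-factor δ i * ∏ (n ∸ i) C-factor δ (n ∸ i)
        ≈⟨ ≈-* (∏-truncate (ℕ.≤-pred i≤n) A-congruent A-trivial δ i ℕ.≤-refl)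
               (∏-truncate (ℕ.m∸n≤m n i) C-congruent C-trivial δ (n ∸ i) ℕ.≤-refl) ⟨
      ∏ n A-factor δ i * ∏ n C-factor δ (n ∸ i)   ∎

  conv-A-factors : ∀ n c → conv (∏ n A-factor δ) c ≈[ n ] ∏ n A-factor c
  conv-A-factors n c = ≈[]-sym (≈[]-trans
    (∏-congruent n A-congruent (≗⇒≈[] (λ j → sym (conv-δ c j))))
    (∏-commute n (λ f → conv f c) A-congruent A-conv-commute δ n))
    where
    A-conv-commute : ∀ k → Commute (A-factor (suc k)) (λ f → conv f c)
    A-conv-commute k = when-commuteˡ (p₂ ∤ᵇ suc k) (when-commuteˡ (p ∤ᵇ suc k)
      (geometric-conv-commute (suc k ℕ.^ d) c (1≤[1+k]^d k)))

  p∣convAC : ∀ n → 1 ≤ n → p ∣ convAC d p p₂ n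
  p∣convAC n 1≤n = ≈0⇒∣ (begin
    + convAC d p p₂ n                             ≈⟨ convAC≈conv n ⟩
    conv (∏ n A-factor δ) (∏ n C-factor δ) n      ≈⟨ conv-A-factors n (∏ n C-factor δ) n ℕ.≤-refl ⟩
    ∏ n A-factor (∏ n C-factor δ) n               ≈⟨ A-factors-cancel-C-factors n n ℕ.≤-refl ⟩
    δ n                                           ≡⟨ δ-pos 1≤n ⟩
    0ℤ                                            ∎)
    where open ≈-Reasoning

theorem2p1 :
    ((d p₂ : ℕ) → 1 ≤ d → 2 ≤ p₂ → ¬ (2 ∣ p₂) →
      (n : ℕ) → A d 2 p₂ n % 2 ≡ B d 2 p₂ n % 2)
    ×
    ((d p₁ p₂ : ℕ) → 1 ≤ d → Prime p₁ → 3 ≤ p₁ → 2 ≤ p₂ → ¬ (p₁ ∣ p₂) →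
      (n : ℕ) → 1 ≤ n → p₁ ∣ convAC d p₁ p₂ n)
theorem2p1 =
  (λ d p₂ 1≤d _ 2∤p₂ → A≡B-mod-2 1≤d 2∤p₂) ,
  (λ d p₁ p₂ 1≤d p₁-prime _ _ p₁∤p₂ → p∣convAC 1≤d p₁-prime p₁∤p₂)
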